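{- Let $A$ be a finite group of order $n$. The number of subsets $S\subseteq A$ for which there exist subgroups $H,K$ with $1<H\leq K<A$ such that $S\setminus K$ is a union of left $H$-cosets is at most $2^{3n/4+2(\log_2 n)^2}$; the same bound holds with right $H$-cosets in place of left $H$-cosets. -}

module Defs where

open import Data.Nat using (ℕ; _+_)
open import Data.Bool using (Bool; true; false)
open import Data.Fin using (Fin)
open import Data.Fin.Properties using (any?; all?; _≟_)
open import Data.Fin.Subset using (Subset; _∈_; _∉_; _⊆_; _∩_; ∁; inside; outside)
open import Data.Fin.Subset.Properties using (_∈?_; _⊆?_; anySubset?)
open import Data.Vec using ([]; _∷_)
open import Data.Product using (Σ; Σ-syntax; ∃; _×_; _,_)
open import Relation.Nullary using (Dec; ¬_; yes; no)
open import Relation.Nullary.Decidable using (⌊_⌋; _×-dec_; _→-dec_; ¬?; map′)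
open import Relation.Binary.PropositionalEquality using (_≡_; _≢_)
open import Algebra.Core using (Op₁; Op₂)

countSubsets : ∀ {n} → (Subset n → Bool) → ℕ
countSubsets {ℕ.zero} f with f []
... | true  = 1
... | false = 0
countSubsets {ℕ.suc n} f =
  countSubsets (λ S → f (inside ∷ S)) + countSubsets (λ S → f (outside ∷ S))

-- Throughout, the group A is given with carrier Fin n (n = |A|), with
-- multiplication _∙_, identity ε, inverse _⁻¹ (group laws assumed separately).
module _ {n : ℕ} (_∙_ : Op₂ (Fin n)) (ε : Fin n) (_⁻¹ : Op₁ (Fin n)) where

  IsSubgroup : Subset n → Set
  IsSubgroup H = (ε ∈ H)
               × (∀ x y → x ∈ H → y ∈ H → (x ∙ y) ∈ H)
               × (∀ x → x ∈ H → (x ⁻¹) ∈ H)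

  Nontrivial : Subset n → Set
  Nontrivial H = ∃ λ h → h ∈ H × h ≢ ε

  Proper : Subset n → Set
  Proper K = ∃ λ x → x ∉ K

  UnionOfLeftCosets : Subset n → Subset n → Set
  UnionOfLeftCosets H T = ∀ x h → x ∈ T → h ∈ H → (x ∙ h) ∈ T

  UnionOfRightCosets : Subset n → Subset n → Set
  UnionOfRightCosets H T = ∀ x h → x ∈ T → h ∈ H → (h ∙ x) ∈ T

  _∖_ : Subset n → Subset n → Subset n
  S ∖ K = S ∩ ∁ K

  GoodLeft : Subset n → Set
  GoodLeft S = Σ[ H ∈ Subset n ] Σ[ K ∈ Subset n ]
      IsSubgroup H × IsSubgroup K × Nontrivial H × H ⊆ K × Proper K
    × UnionOfLeftCosets H (S ∖ K)

  GoodRight : Subset n → Set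
  GoodRight S = Σ[ H ∈ Subset n ] Σ[ K ∈ Subset n ]
      IsSubgroup H × IsSubgroup K × Nontrivial H × H ⊆ K × Proper K
    × UnionOfRightCosets H (S ∖ K)

  isSubgroup? : ∀ H → Dec (IsSubgroup H)
  isSubgroup? H = (ε ∈? H)
    ×-dec all? (λ x → all? (λ y → (x ∈? H) →-dec ((y ∈? H) →-dec ((x ∙ y) ∈? H))))
    ×-dec all? (λ x → (x ∈? H) →-dec ((x ⁻¹) ∈? H))

  nontrivial? : ∀ H → Dec (Nontrivial H)
  nontrivial? H = any? (λ h → (h ∈? H) ×-dec ¬? (h ≟ ε))

  proper? : ∀ K → Dec (Proper K)
  proper? K = any? (λ x → ¬? (x ∈? K))

  leftCosets? : ∀ H T → Dec (UnionOfLeftCosets H T)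
  leftCosets? H T = all? (λ x → all? (λ h →
    (x ∈? T) →-dec ((h ∈? H) →-dec ((x ∙ h) ∈? T))))

  rightCosets? : ∀ H T → Dec (UnionOfRightCosets H T)
  rightCosets? H T = all? (λ x → all? (λ h →
    (x ∈? T) →-dec ((h ∈? H) →-dec ((h ∙ x) ∈? T))))

  goodLeft? : ∀ S → Dec (GoodLeft S)
  goodLeft? S = anySubset? (λ H → anySubset? (λ K →
    isSubgroup? H ×-dec isSubgroup? K ×-dec nontrivial? H ×-dec (H ⊆? K)
    ×-dec proper? K ×-dec leftCosets? H (S ∖ K)))

  goodRight? : ∀ S → Dec (GoodRight S)
  goodRight? S = anySubset? (λ H → anySubset? (λ K →
    isSubgroup? H ×-dec isSubgroup? K ×-dec nontrivial? H ×-dec (H ⊆? K)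
    ×-dec proper? K ×-dec rightCosets? H (S ∖ K)))

  #GoodLeft : ℕ
  #GoodLeft = countSubsets (λ S → ⌊ goodLeft? S ⌋)

  #GoodRight : ℕ
  #GoodRight = countSubsets (λ S → ⌊ goodRight? S ⌋)

module Submission where

-- If S ∖ K is a union of left H-cosets, then S ∖ K is closed under right multiplication by a
-- single element h ≠ 1 of H ⊆ K. A proper subgroup K has at most n/2 elements, and adjoining a
-- new element to a list of elements of K at least doubles the subgroup they generate, so K is
-- generated by L elements whenever n ≤ 2^(L+1). Hence every such S lies in one of n^(L+1)
-- families, indexed by h and a list v of generators of K. Within a family S is closed under
-- x ↦ x h off K, so it is determined by S ∩ K together with S ∩ R for a set R containing one
-- point of each ⟨h⟩-orbit outside K. As h ≠ 1, R and R h are disjoint subsets of A ∖ K, so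
-- |K| + |R| ≤ |K| + (n − |K|)/2 ≤ 3n/4 and each family has at most 2^(3n/4) members.
-- Choosing 2^L < n ≤ 2^(L+1) makes L + 1 ≤ 2 log₂ n, so n^(L+1) ≤ 2^(2 (log₂ n)²). Right cosets
-- are left cosets of the opposite group.

open import Algebra.Bundles using (Group)
open import Algebra.Core using (Op₁; Op₂)
import Algebra.Construct.Flip.Op as Flip
open import Algebra.Structures using (IsGroup)
open import Data.Bool using (Bool; true; false; T; not; _∧_; _∨_; if_then_else_)
open import Data.Bool.ListAction using (any)
open import Data.Bool.Properties using (T-∨; T-∧; T?)
open import Data.Empty using (⊥-elim)
open import Data.Fin as Fin using (Fin; zero; suc; toℕ; fromℕ<)
open import Data.Fin.Induction using (<-wellFounded)
open import Data.Fin.Permutation as Perm using (Permutation′; _⟨$⟩ʳ_; _⟨$⟩ˡ_)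
open import Data.Fin.Properties using (_≟_; any?; all?; ¬∀⟶∃¬; pigeonhole; toℕ-injective; toℕ-fromℕ<)
open import Data.Fin.Subset using (Subset; inside; outside; _∈_; _⊆_)
open import Data.Fin.Subset.Properties
  using (_∈?_; anySubset?; drop-∷-⊆; x∈p∩q⁺; x∈p∩q⁻; x∉p⇒x∈∁p)
open import Data.List using (List; []; _∷_; allFin; length)
open import Data.List.Membership.Propositional using (lose)
open import Data.List.Membership.Propositional.Properties using (∈-allFin)
open import Data.List.Properties using (length-tabulate)
open import Data.List.Relation.Unary.Any.Properties using (any⁺)
open import Data.Nat using (ℕ; NonZero; zero; suc; _+_; _*_; _^_; _∸_; _≤_; _<_; z≤n; s≤s)
open import Data.Nat.DivMod using (_/_; _%_; m≡m%n+[m/n]*n; m%n<n; m*n/n≡m; m/n*n≤m; /-monoˡ-≤)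
open import Data.Nat.Properties
  using (≤-refl; ≤-trans; ≤-reflexive; ≤-antisym; <-irrefl; ≤-<-trans; <⇒≤; <⇒≱; ≰⇒>; _≤?_; m≤m+n;
         m≤n+m; m≤n⇒m≤1+n; m<n⇒m<1+n; n<1+n; +-identityʳ; +-suc; +-comm; +-mono-≤; +-monoʳ-≤;
         *-comm; *-assoc; *-suc; *-mono-≤; *-monoˡ-≤; *-monoʳ-≤; m+[n∸m]≡n; m^n>0; ^-zeroˡ;
         ^-*-assoc; ^-distribˡ-+-*; ^-monoˡ-≤; ^-monoʳ-≤; ^-monoʳ-<; +-0-commutativeMonoid;
         +-commutativeSemigroup; module ≤-Reasoning)
open import Data.Nat.Tactic.RingSolver using (solve-∀)
open import Data.Product using (∃; _×_; _,_; proj₁; proj₂; uncurry)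
open import Data.Sum using (_⊎_; inj₁; inj₂; [_,_]; [_,_]′)
open import Data.Vec using (Vec; []; _∷_; here; there)
open import Data.Vec.Relation.Unary.All as All using (All; []; _∷_)
open import Function using (_∘_; id; flip; case_of_; Equivalence)
open import Induction.WellFounded using (Acc; acc)
open import Level using (0ℓ)
open import Relation.Binary.PropositionalEquality hiding ([_])
open import Relation.Nullary using (¬_; ¬?; Dec; yes; no)
open import Relation.Nullary.Decidable
  using (⌊_⌋; isNo; toWitness; fromWitness; toWitnessFalse; fromWitnessFalse; decidable-stable;
         _×-dec_; _→-dec_)

open import Algebra.Properties.CommutativeMonoid.Sum +-0-commutativeMonoid
  using (sum-syntax; ∑-distrib-+; sum-cong-≗; sum-permute)
open import Algebra.Properties.CommutativeSemigroup +-commutativeSemigroup using (interchange)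

open import Defs

-- Arithmetic

*-≤⇒≤-/ : ∀ n .{{_ : NonZero n}} {m o} → n * m ≤ o → m ≤ o / n
*-≤⇒≤-/ n {m} {o} nm≤o = begin
  m          ≡⟨ m*n/n≡m m n ⟨
  m * n / n  ≤⟨ /-monoˡ-≤ n (≤-trans (≤-reflexive (*-comm m n)) nm≤o) ⟩
  o / n      ∎
  where open ≤-Reasoning

^-distribʳ-* : ∀ m n o → (m * n) ^ o ≡ m ^ o * n ^ o
^-distribʳ-* m n zero    = refl
^-distribʳ-* m n (suc o) = trans (cong (m * n *_) (^-distribʳ-* m n o)) (swap-middle m n (m ^ o) (n ^ o))
  where
  swap-middle : ∀ a b c d → a * b * (c * d) ≡ a * c * (b * d)
  swap-middle = solve-∀

2^m<2^n⇒m<n : ∀ {m n} → 2 ^ m < 2 ^ n → m < n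
2^m<2^n⇒m<n 2ᵐ<2ⁿ = ≰⇒> λ n≤m → <⇒≱ 2ᵐ<2ⁿ (^-monoʳ-≤ 2 n≤m)

binary-magnitude : ∀ n → 2 ≤ n → ∃ λ L → 2 ^ L < n × n ≤ 2 ^ suc L
binary-magnitude (suc zero) (s≤s ())
binary-magnitude (suc (suc zero)) _ = 0 , s≤s (s≤s z≤n) , ≤-refl
binary-magnitude (suc n@(suc (suc _))) _ with binary-magnitude n (s≤s (s≤s z≤n))
... | L , 2ᴸ<n , n≤2ᴸ⁺¹ with suc n ≤? 2 ^ suc L
...   | yes 1+n≤2ᴸ⁺¹ = L , m<n⇒m<1+n 2ᴸ<n , 1+n≤2ᴸ⁺¹
...   | no  1+n≰2ᴸ⁺¹ = suc L , ≰⇒> 1+n≰2ᴸ⁺¹ , (begin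
  1 + n                    ≤⟨ +-mono-≤ (m^n>0 2 (suc L)) n≤2ᴸ⁺¹ ⟩
  2 ^ suc L + 2 ^ suc L    ≡⟨ cong (2 ^ suc L +_) (+-identityʳ _) ⟨
  2 ^ suc (suc L)          ∎)
  where open ≤-Reasoning

≤1⇒^≤2^ : ∀ {c k e} → c ≤ 1 → c ^ k ≤ 2 ^ e
≤1⇒^≤2^ {k = k} {e} c≤1 = ≤-trans (^-monoˡ-≤ k c≤1) (≤-trans (≤-reflexive (^-zeroˡ k)) (m^n>0 2 e))

power-bound : ∀ {n c a b m q} → c ≤ n ^ m * 2 ^ q → 4 * q ≤ 3 * n → b * m ≤ 2 * a → n ^ b ≤ 2 ^ a →
              c ^ (4 * (b * b)) ≤ 2 ^ (3 * n * (b * b) + 8 * (a * a))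
power-bound {n} {c} {a} {b} {m} {q} c≤nᵐ2^q 4q≤3n bm≤2a nᵇ≤2ᵃ = begin
  c ^ k                                      ≤⟨ ^-monoˡ-≤ k c≤nᵐ2^q ⟩
  (n ^ m * 2 ^ q) ^ k                        ≡⟨ ^-distribʳ-* (n ^ m) (2 ^ q) k ⟩
  (n ^ m) ^ k * (2 ^ q) ^ k                  ≤⟨ *-mono-≤ nᵐ-part 2^q-part ⟩
  2 ^ (8 * (a * a)) * 2 ^ (3 * n * (b * b))  ≡⟨ ^-distribˡ-+-* 2 (8 * (a * a)) _ ⟨
  2 ^ (8 * (a * a) + 3 * n * (b * b))        ≡⟨ cong (2 ^_) (+-comm (8 * (a * a)) _) ⟩
  2 ^ (3 * n * (b * b) + 8 * (a * a))        ∎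
  where
  open ≤-Reasoning
  k = 4 * (b * b)
  nᵐ-part : (n ^ m) ^ k ≤ 2 ^ (8 * (a * a))
  nᵐ-part = begin
    (n ^ m) ^ k                  ≡⟨ trans (^-*-assoc n m k) (cong (n ^_) (regroup m b)) ⟩
    n ^ (b * (4 * (b * m)))      ≡⟨ ^-*-assoc n b (4 * (b * m)) ⟨
    (n ^ b) ^ (4 * (b * m))      ≤⟨ ^-monoˡ-≤ (4 * (b * m)) nᵇ≤2ᵃ ⟩
    (2 ^ a) ^ (4 * (b * m))      ≡⟨ ^-*-assoc 2 a (4 * (b * m)) ⟩
    2 ^ (a * (4 * (b * m)))      ≤⟨ ^-monoʳ-≤ 2 (*-monoʳ-≤ a (*-monoʳ-≤ 4 bm≤2a)) ⟩
    2 ^ (a * (4 * (2 * a)))      ≡⟨ cong (2 ^_) (eight a) ⟩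
    2 ^ (8 * (a * a))            ∎
    where
    regroup : ∀ m b → m * (4 * (b * b)) ≡ b * (4 * (b * m))
    regroup = solve-∀
    eight : ∀ a → a * (4 * (2 * a)) ≡ 8 * (a * a)
    eight = solve-∀
  2^q-part : (2 ^ q) ^ k ≤ 2 ^ (3 * n * (b * b))
  2^q-part = begin
    (2 ^ q) ^ k                  ≡⟨ ^-*-assoc 2 q k ⟩
    2 ^ (q * (4 * (b * b)))      ≡⟨ cong (2 ^_) (regroup q b) ⟩
    2 ^ (4 * q * (b * b))        ≤⟨ ^-monoʳ-≤ 2 (*-monoˡ-≤ (b * b) 4q≤3n) ⟩
    2 ^ (3 * n * (b * b))        ∎
    where
    regroup : ∀ q b → q * (4 * (b * b)) ≡ 4 * q * (b * b)
    regroup = solve-∀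

bound-from-counts : ∀ {n c} a b → n ^ b < 2 ^ a →
                    (∀ L → n ≤ 2 ^ suc L → c ≤ n ^ suc L * 2 ^ (3 * n / 4)) →
                    c ^ (4 * (b * b)) ≤ 2 ^ (3 * n * (b * b) + 8 * (a * a))
bound-from-counts {zero}     a b _ count =
  ≤1⇒^≤2^ {k = 4 * (b * b)} {3 * 0 * (b * b) + 8 * (a * a)} (≤-trans (count 0 z≤n) z≤n)
bound-from-counts {suc zero} a b _ count =
  ≤1⇒^≤2^ {k = 4 * (b * b)} {3 * 1 * (b * b) + 8 * (a * a)} (count 0 (s≤s z≤n))
bound-from-counts {n@(suc (suc _))} {c} a b nᵇ<2ᵃ count with binary-magnitude n (s≤s (s≤s z≤n))
... | L , 2ᴸ<n , n≤2ᴸ⁺¹ =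
  power-bound {n} {c} {a} {b} {suc L} {3 * n / 4} (count L n≤2ᴸ⁺¹)
    (≤-trans (≤-reflexive (*-comm 4 (3 * n / 4))) (m/n*n≤m (3 * n) 4)) b[1+L]≤2a (<⇒≤ nᵇ<2ᵃ)
  where
  b<a : b < a
  b<a = 2^m<2^n⇒m<n (≤-<-trans (^-monoˡ-≤ b (s≤s (s≤s z≤n))) nᵇ<2ᵃ)
  Lb<a : L * b < a
  Lb<a = 2^m<2^n⇒m<n (begin-strict
    2 ^ (L * b)  ≡⟨ ^-*-assoc 2 L b ⟨
    (2 ^ L) ^ b  ≤⟨ ^-monoˡ-≤ b (<⇒≤ 2ᴸ<n) ⟩
    n ^ b        <⟨ nᵇ<2ᵃ ⟩
    2 ^ a        ∎)
    where open ≤-Reasoning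
  b[1+L]≤2a : b * suc L ≤ 2 * a
  b[1+L]≤2a = begin
    b * suc L  ≡⟨ trans (*-suc b L) (cong (b +_) (*-comm b L)) ⟩
    b + L * b  ≤⟨ +-mono-≤ (<⇒≤ b<a) (<⇒≤ Lb<a) ⟩
    a + a      ≡⟨ cong (a +_) (+-identityʳ a) ⟨
    2 * a      ∎
    where open ≤-Reasoning

-- Counting families of subsets

count-mono : ∀ {n} {f g : Subset n → Bool} → (∀ {S} → T (f S) → T (g S)) →
             countSubsets f ≤ countSubsets g
count-mono {zero} {f} {g} f⇒g with f [] | g [] | f⇒g {[]}
... | false | _     | _   = z≤n
... | true  | true  | _   = ≤-refl
... | true  | false | f⇒g = ⊥-elim (f⇒g _)
count-mono {suc n} {f} {g} f⇒g =
  +-mono-≤ (count-mono {f = f ∘ (inside ∷_)} {g ∘ (inside ∷_)} f⇒g)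
           (count-mono {f = f ∘ (outside ∷_)} {g ∘ (outside ∷_)} f⇒g)

count-∅ : ∀ {n} (f : Subset n → Bool) → (∀ {S} → ¬ T (f S)) → countSubsets f ≡ 0
count-∅ {zero} f ¬f with f [] | ¬f {[]}
... | false | _  = refl
... | true  | ¬t = ⊥-elim (¬t _)
count-∅ {suc n} f ¬f = cong₂ _+_ (count-∅ (f ∘ (inside ∷_)) ¬f) (count-∅ (f ∘ (outside ∷_)) ¬f)

count-∨-∧ : ∀ {n} (f g : Subset n → Bool) →
            countSubsets (λ S → f S ∨ g S) + countSubsets (λ S → f S ∧ g S) ≡
            countSubsets f + countSubsets g
count-∨-∧ {zero} f g with f [] | g []
... | false | false = refl
... | false | true  = refl
... | true  | false = refl
... | true  | true  = refl
count-∨-∧ {suc n} f g = begin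
  (c₁ (f ∨ᶠ g) + c₀ (f ∨ᶠ g)) + (c₁ (f ∧ᶠ g) + c₀ (f ∧ᶠ g))  ≡⟨ interchange (c₁ (f ∨ᶠ g)) _ _ _ ⟩
  (c₁ (f ∨ᶠ g) + c₁ (f ∧ᶠ g)) + (c₀ (f ∨ᶠ g) + c₀ (f ∧ᶠ g))
    ≡⟨ cong₂ _+_ (count-∨-∧ (f ∘ (inside ∷_)) _) (count-∨-∧ (f ∘ (outside ∷_)) _) ⟩
  (c₁ f + c₁ g) + (c₀ f + c₀ g)                              ≡⟨ interchange (c₁ f) _ _ _ ⟩
  (c₁ f + c₀ f) + (c₁ g + c₀ g)                              ∎
  where
  open ≡-Reasoning
  c₁ c₀ : (Subset (suc n) → Bool) → ℕ
  c₁ h = countSubsets (h ∘ (inside ∷_))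
  c₀ h = countSubsets (h ∘ (outside ∷_))
  _∨ᶠ_ _∧ᶠ_ : (Subset (suc n) → Bool) → (Subset (suc n) → Bool) → Subset (suc n) → Bool
  (f ∨ᶠ g) S = f S ∨ g S
  (f ∧ᶠ g) S = f S ∧ g S

count-∨ : ∀ {n} (f g : Subset n → Bool) →
          countSubsets (λ S → f S ∨ g S) ≤ countSubsets f + countSubsets g
count-∨ f g = ≤-trans (m≤m+n _ _) (≤-reflexive (count-∨-∧ f g))

count-disjoint : ∀ {n} (f g : Subset n → Bool) → (∀ {S} → T (f S) → ¬ T (g S)) →
                 countSubsets f + countSubsets g ≡ countSubsets (λ S → f S ∨ g S)
count-disjoint f g disjoint = begin
  countSubsets f + countSubsets g                                  ≡⟨ count-∨-∧ f g ⟨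
  countSubsets (λ S → f S ∨ g S) + countSubsets (λ S → f S ∧ g S)
    ≡⟨ cong (countSubsets (λ S → f S ∨ g S) +_)
            (count-∅ (λ S → f S ∧ g S) (uncurry disjoint ∘ Equivalence.to T-∧)) ⟩
  countSubsets (λ S → f S ∨ g S) + 0                               ≡⟨ +-identityʳ _ ⟩
  countSubsets (λ S → f S ∨ g S)                                   ∎
  where open ≡-Reasoning

count-any : ∀ {n} {A : Set} (xs : List A) (g : A → Subset n → Bool) {B : ℕ} →
            (∀ a → countSubsets (g a) ≤ B) →
            countSubsets (λ S → any (λ a → g a S) xs) ≤ length xs * B
count-any {n} []       g bound = ≤-reflexive (count-∅ {n} (λ _ → false) λ ())
count-any     (a ∷ xs) g bound = ≤-trans (count-∨ (g a) _) (+-mono-≤ (bound a) (count-any xs g bound))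

anyCode : ∀ {m} k → (Vec (Fin m) k → Bool) → Bool
anyCode zero    p = p []
anyCode (suc k) p = any (λ x → anyCode k (p ∘ (x ∷_))) (allFin _)

anyCode⁺ : ∀ {m k} (p : Vec (Fin m) k → Bool) w → T (p w) → T (anyCode k p)
anyCode⁺ p []      pw = pw
anyCode⁺ p (x ∷ w) pw = any⁺ _ (lose (∈-allFin x) (anyCode⁺ (p ∘ (x ∷_)) w pw))

count-anyCode : ∀ {n m} k (g : Vec (Fin m) k → Subset n → Bool) {B : ℕ} →
                (∀ w → countSubsets (g w) ≤ B) →
                countSubsets (λ S → anyCode k (λ w → g w S)) ≤ m ^ k * B
count-anyCode zero g bound = ≤-trans (bound []) (≤-reflexive (sym (+-identityʳ _)))
count-anyCode {m = m} (suc k) g {B} bound = begin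
  countSubsets (λ S → anyCode (suc k) (λ w → g w S))
    ≤⟨ count-any (allFin m) (λ x S → anyCode k (λ w → g (x ∷ w) S))
                 (λ x → count-anyCode k (g ∘ (x ∷_)) (bound ∘ (x ∷_))) ⟩
  length (allFin m) * (m ^ k * B)  ≡⟨ cong (_* (m ^ k * B)) (length-tabulate {n = m} id) ⟩
  m * (m ^ k * B)                  ≡⟨ *-assoc m (m ^ k) B ⟨
  m ^ suc k * B                    ∎
  where open ≤-Reasoning

count-cover : ∀ {n m} k (g : Vec (Fin m) k → Subset n → Bool) {B : ℕ} (f : Subset n → Bool) →
              (∀ w → countSubsets (g w) ≤ B) → (∀ {S} → T (f S) → ∃ λ w → T (g w S)) →
              countSubsets f ≤ m ^ k * B
count-cover k g f bound cover = ≤-trans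
  (count-mono {f = f} (λ fS → let w , gwS = cover fS in anyCode⁺ (λ w → g w _) w gwS))
  (count-anyCode k g bound)

-- Cardinalities of subsets given by boolean predicates

card : ∀ {n} → (Fin n → Bool) → ℕ
card p = ∑[ x < _ ] (if p x then 1 else 0)

card-mono : ∀ {n} (p q : Fin n → Bool) → (∀ {x} → T (p x) → T (q x)) → card p ≤ card q
card-mono {zero}  p q p⇒q = z≤n
card-mono {suc n} p q p⇒q with p zero | q zero | p⇒q {zero}
... | false | false | _   = card-mono (p ∘ suc) (q ∘ suc) p⇒q
... | false | true  | _   = m≤n⇒m≤1+n (card-mono (p ∘ suc) (q ∘ suc) p⇒q)
... | true  | true  | _   = s≤s (card-mono (p ∘ suc) (q ∘ suc) p⇒q)
... | true  | false | p⇒q = ⊥-elim (p⇒q _)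

card-∅ : ∀ {n} (p : Fin n → Bool) → (∀ {x} → ¬ T (p x)) → card p ≡ 0
card-∅ {zero}  p ¬p = refl
card-∅ {suc n} p ¬p with p zero | ¬p {zero}
... | false | _  = card-∅ (p ∘ suc) ¬p
... | true  | ¬t = ⊥-elim (¬t _)

card-⊤ : ∀ {n} → card {n} (λ _ → true) ≡ n
card-⊤ {zero}  = refl
card-⊤ {suc n} = cong suc (card-⊤ {n})

card-pos : ∀ {n} (p : Fin n → Bool) {x} → T (p x) → 0 < card p
card-pos p {zero} px with p zero
... | true = s≤s z≤n
card-pos p {suc x} px = ≤-trans (card-pos (p ∘ suc) px) (m≤n+m _ _)

card-not : ∀ {n} (p : Fin n → Bool) → card p + card (not ∘ p) ≡ n
card-not {zero}  p = refl
card-not {suc n} p with p zero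
... | true  = cong suc (card-not (p ∘ suc))
... | false = trans (+-suc _ _) (cong suc (card-not (p ∘ suc)))

card-∨-∧ : ∀ {n} (p q : Fin n → Bool) →
           card (λ x → p x ∨ q x) + card (λ x → p x ∧ q x) ≡ card p + card q
card-∨-∧ {n} p q = begin
  card (λ x → p x ∨ q x) + card (λ x → p x ∧ q x)
    ≡⟨ ∑-distrib-+ (λ x → 𝟙 (p x ∨ q x)) (λ x → 𝟙 (p x ∧ q x)) ⟨
  ∑[ x < n ] (𝟙 (p x ∨ q x) + 𝟙 (p x ∧ q x))  ≡⟨ sum-cong-≗ (λ x → 𝟙-∨-∧ (p x) (q x)) ⟩
  ∑[ x < n ] (𝟙 (p x) + 𝟙 (q x))              ≡⟨ ∑-distrib-+ (𝟙 ∘ p) (𝟙 ∘ q) ⟩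
  card p + card q                             ∎
  where
  open ≡-Reasoning
  𝟙 : Bool → ℕ
  𝟙 b = if b then 1 else 0
  𝟙-∨-∧ : ∀ a b → 𝟙 (a ∨ b) + 𝟙 (a ∧ b) ≡ 𝟙 a + 𝟙 b
  𝟙-∨-∧ false b     = +-identityʳ (𝟙 b)
  𝟙-∨-∧ true  false = refl
  𝟙-∨-∧ true  true  = refl

card-∨ : ∀ {n} (p q : Fin n → Bool) → card (λ x → p x ∨ q x) ≤ card p + card q
card-∨ p q = ≤-trans (m≤m+n _ _) (≤-reflexive (card-∨-∧ p q))

card-permute : ∀ {n} (π : Permutation′ n) (p : Fin n → Bool) → card (p ∘ (π ⟨$⟩ʳ_)) ≡ card p
card-permute π p = sym (sum-permute _ π)

card-double : ∀ {n} (π : Permutation′ n) {p q : Fin n → Bool} →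
              (∀ {x} → T (p x) → ¬ T (p (π ⟨$⟩ʳ x))) →
              (∀ {x} → T (p x) → T (q x)) → (∀ {x} → T (p x) → T (q (π ⟨$⟩ʳ x))) →
              2 * card p ≤ card q
card-double π {p} {q} disjoint p⊆q πp⊆q = begin
  2 * card p                                         ≡⟨ cong (card p +_) (+-identityʳ (card p)) ⟩
  card p + card p                                    ≡⟨ cong (card p +_) (card-permute (Perm.flip π) p) ⟨
  card p + card p′                                   ≡⟨ card-∨-∧ p p′ ⟨
  card (λ x → p x ∨ p′ x) + card (λ x → p x ∧ p′ x)
    ≡⟨ cong (card (λ x → p x ∨ p′ x) +_)
            (card-∅ (λ x → p x ∧ p′ x) (uncurry apart ∘ Equivalence.to T-∧)) ⟩
  card (λ x → p x ∨ p′ x) + 0  ≡⟨ +-identityʳ _ ⟩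
  card (λ x → p x ∨ p′ x)      ≤⟨ card-mono _ q ([ p⊆q , covered ] ∘ Equivalence.to T-∨) ⟩
  card q                       ∎
  where
  open ≤-Reasoning
  p′ : Fin _ → Bool
  p′ x = p (π ⟨$⟩ˡ x)
  apart : ∀ {x} → T (p x) → ¬ T (p′ x)
  apart px p′x = disjoint p′x (subst (T ∘ p) (sym (Perm.inverseʳ π)) px)
  covered : ∀ {x} → T (p′ x) → T (q x)
  covered p′x = subst (T ∘ q) (Perm.inverseʳ π) (πp⊆q p′x)

agree-∷ : ∀ {n} (D : Fin (suc n) → Bool) {b b′} {S S′ : Subset n} →
          (T (D zero) → zero ∈ b ∷ S → zero ∈ b′ ∷ S′) → (∀ {x} → T (D (suc x)) → x ∈ S → x ∈ S′) →
          ∀ {x} → T (D x) → x ∈ b ∷ S → x ∈ b′ ∷ S′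
agree-∷ D at-zero agree {zero}  d x∈         = at-zero d x∈
agree-∷ D at-zero agree {suc x} d (there x∈) = there (agree d x∈)

count-determined : ∀ {n} (f : Subset n → Bool) (D : Fin n → Bool) →
                   (∀ {S S′} → T (f S) → T (f S′) → (∀ {x} → T (D x) → x ∈ S → x ∈ S′) → S ⊆ S′) →
                   countSubsets f ≤ 2 ^ card D
count-determined {zero} f D _ with f []
... | false = z≤n
... | true  = ≤-refl
count-determined {suc n} f D determined with D zero in D₀
... | true = begin
  countSubsets (f ∘ (inside ∷_)) + countSubsets (f ∘ (outside ∷_))
    ≤⟨ +-mono-≤ (count-determined _ (D ∘ suc) (tail inside))
                (count-determined _ (D ∘ suc) (tail outside)) ⟩
  2 ^ card (D ∘ suc) + 2 ^ card (D ∘ suc)      ≡⟨ cong (2 ^ card (D ∘ suc) +_) (+-identityʳ _) ⟨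
  2 ^ suc (card (D ∘ suc))                     ∎
  where
  open ≤-Reasoning
  tail : ∀ b {S S′} → T (f (b ∷ S)) → T (f (b ∷ S′)) → (∀ {x} → T (D (suc x)) → x ∈ S → x ∈ S′) → S ⊆ S′
  tail b {S} {S′} fS fS′ agree =
    drop-∷-⊆ (determined {b ∷ S} {b ∷ S′} fS fS′ (agree-∷ D (λ { _ here → here }) agree))
... | false = begin
  countSubsets (f ∘ (inside ∷_)) + countSubsets (f ∘ (outside ∷_))
    ≡⟨ count-disjoint (f ∘ (inside ∷_)) (f ∘ (outside ∷_)) head-unique ⟩
  countSubsets (λ S → f (inside ∷ S) ∨ f (outside ∷ S))  ≤⟨ count-determined _ (D ∘ suc) merged ⟩
  2 ^ card (D ∘ suc)                                      ∎
  where
  open ≤-Reasoning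
  zero∉D : ¬ T (D zero)
  zero∉D = subst T D₀
  head-unique : ∀ {S} → T (f (inside ∷ S)) → ¬ T (f (outside ∷ S))
  head-unique {S} fS fS′ = case inside∷S⊆outside∷S here of λ ()
    where
    inside∷S⊆outside∷S =
      determined {inside ∷ S} {outside ∷ S} fS fS′ (agree-∷ D (⊥-elim ∘ zero∉D) (λ _ → id))
  some-head : ∀ {S} → T (f (inside ∷ S) ∨ f (outside ∷ S)) → ∃ λ b → T (f (b ∷ S))
  some-head = [ (inside ,_) , (outside ,_) ]′ ∘ Equivalence.to T-∨
  merged : ∀ {S S′} → T (f (inside ∷ S) ∨ f (outside ∷ S)) → T (f (inside ∷ S′) ∨ f (outside ∷ S′)) →
           (∀ {x} → T (D (suc x)) → x ∈ S → x ∈ S′) → S ⊆ S′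
  merged {S} {S′} fS fS′ agree with some-head fS | some-head fS′
  ... | b , fbS | b′ , fb′S′ =
    drop-∷-⊆ (determined {b ∷ S} {b′ ∷ S′} fbS fb′S′ (agree-∷ D (⊥-elim ∘ zero∉D) agree))

T-not⁺ : ∀ {b} → ¬ T b → T (not b)
T-not⁺ {false} _  = _
T-not⁺ {true}  ¬t = ¬t _

-- Subgroups of a finite group with carrier Fin n

module _ {n : ℕ} {_∙_ : Op₂ (Fin n)} {ε : Fin n} {_⁻¹ : Op₁ (Fin n)}
         (isGroup : IsGroup _≡_ _∙_ ε _⁻¹) where

  private
    group : Group 0ℓ 0ℓ
    group = record { isGroup = isGroup }

  open IsGroup isGroup using (assoc; identityˡ; identityʳ)
  open import Algebra.Properties.Group group
    using (\\-leftDividesˡ; \\-leftDividesʳ; //-rightDividesˡ; //-rightDividesʳ; ∙-cancelˡ)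
  open import Algebra.Properties.Monoid.Mult (Group.monoid group)
    using (×-homo-+; ×-homo-1) renaming (_×_ to _⋆_)

  leftTranslation rightTranslation : Fin n → Permutation′ n
  leftTranslation  g = Perm.permutation (g ∙_) ((g ⁻¹) ∙_) (\\-leftDividesˡ g) (\\-leftDividesʳ g)
  rightTranslation g = Perm.permutation (_∙ g) (_∙ (g ⁻¹)) (//-rightDividesˡ g) (//-rightDividesʳ g)

  -- Subgroups given by a Boolean membership test, so that card can count their elements.
  record IsSubgroupᵇ (P : Fin n → Bool) : Set where
    field
      ε-closed  : T (P ε)
      ∙-closed  : ∀ {x y} → T (P x) → T (P y) → T (P (x ∙ y))
      ⁻¹-closed : ∀ {x} → T (P x) → T (P (x ⁻¹))

    ∙-cancelˡ-∈ : ∀ {x y} → T (P x) → T (P (x ∙ y)) → T (P y)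
    ∙-cancelˡ-∈ px pxy = subst (T ∘ P) (\\-leftDividesʳ _ _) (∙-closed (⁻¹-closed px) pxy)

    ∙-cancelʳ-∈ : ∀ {x y} → T (P y) → T (P (x ∙ y)) → T (P x)
    ∙-cancelʳ-∈ py pxy = subst (T ∘ P) (//-rightDividesʳ _ _) (∙-closed pxy (⁻¹-closed py))

    ∙-∉ : ∀ {x y} → T (P y) → ¬ T (P x) → ¬ T (P (x ∙ y))
    ∙-∉ py x∉P = x∉P ∘ ∙-cancelʳ-∈ py

  open IsSubgroupᵇ

  card-proper-subgroup : ∀ {P} → IsSubgroupᵇ P → ∀ {x₀} → ¬ T (P x₀) → 2 * card P ≤ n
  card-proper-subgroup P-sub {x₀} x₀∉P = ≤-trans
    (card-double (leftTranslation x₀) {q = λ _ → true} (λ py pxy → x₀∉P (∙-cancelʳ-∈ P-sub py pxy))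
                 (λ _ → _) (λ _ → _))
    (≤-reflexive card-⊤)

  Subgroup : Subset n → Set
  Subgroup = IsSubgroup _∙_ ε _⁻¹

  -- x ∈ ⟨ v ⟩ iff x lies in every subgroup containing all entries of v.
  ⟨_⟩ : ∀ {k} → Vec (Fin n) k → Fin n → Bool
  ⟨ v ⟩ x = isNo (anySubset? λ H → isSubgroup? _∙_ ε _⁻¹ H ×-dec All.all? (_∈? H) v ×-dec ¬? (x ∈? H))

  ⟨⟩-least : ∀ {k} {v : Vec (Fin n) k} {x H} → T (⟨ v ⟩ x) → Subgroup H → All (_∈ H) v → x ∈ H
  ⟨⟩-least {x = x} {H} x∈⟨v⟩ H-sub v⊆H =
    decidable-stable (x ∈? H) (λ x∉H → toWitnessFalse x∈⟨v⟩ (H , H-sub , v⊆H , x∉H))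

  ⟨⟩-intro : ∀ {k} {v : Vec (Fin n) k} {x} → (∀ {H} → Subgroup H → All (_∈ H) v → x ∈ H) → T (⟨ v ⟩ x)
  ⟨⟩-intro x∈all = fromWitnessFalse λ (_ , H-sub , v⊆H , x∉H) → x∉H (x∈all H-sub v⊆H)

  ⟨⟩-isSubgroup : ∀ {k} (v : Vec (Fin n) k) → IsSubgroupᵇ ⟨ v ⟩
  ⟨⟩-isSubgroup v = record
    { ε-closed  = ⟨⟩-intro λ (ε∈H , _) _ → ε∈H
    ; ∙-closed  = λ x∈ y∈ → ⟨⟩-intro λ H-sub@(_ , ∙∈H , _) v⊆H →
                    ∙∈H _ _ (⟨⟩-least x∈ H-sub v⊆H) (⟨⟩-least y∈ H-sub v⊆H)
    ; ⁻¹-closed = λ x∈ → ⟨⟩-intro λ H-sub@(_ , _ , ⁻¹∈H) v⊆H → ⁻¹∈H _ (⟨⟩-least x∈ H-sub v⊆H)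
    }

  ⟨⟩-⊆-∷ : ∀ {k} {v : Vec (Fin n) k} {g x} → T (⟨ v ⟩ x) → T (⟨ g ∷ v ⟩ x)
  ⟨⟩-⊆-∷ x∈ = ⟨⟩-intro λ { H-sub (_ ∷ v⊆H) → ⟨⟩-least x∈ H-sub v⊆H }

  ∈-⟨∷⟩ : ∀ {k} {v : Vec (Fin n) k} {g} → T (⟨ g ∷ v ⟩ g)
  ∈-⟨∷⟩ = ⟨⟩-intro λ { _ (g∈H ∷ _) → g∈H }

  ⟨∷⟩-doubles : ∀ {k} {v : Vec (Fin n) k} {g} → ¬ T (⟨ v ⟩ g) → 2 * card ⟨ v ⟩ ≤ card ⟨ g ∷ v ⟩
  ⟨∷⟩-doubles {v = v} g∉⟨v⟩ = card-double (rightTranslation _)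
    (λ x∈ xg∈ → g∉⟨v⟩ (∙-cancelˡ-∈ (⟨⟩-isSubgroup v) x∈ xg∈))
    ⟨⟩-⊆-∷ (λ x∈ → ∙-closed (⟨⟩-isSubgroup _) (⟨⟩-⊆-∷ x∈) ∈-⟨∷⟩)

  _⊆⟨_⟩ : ∀ {k} → Subset n → Vec (Fin n) k → Set
  K ⊆⟨ v ⟩ = ∀ {x} → x ∈ K → T (⟨ v ⟩ x)

  ⊆⟨⟩-or-doubles : ∀ {k} K (v : Vec (Fin n) k) →
                   K ⊆⟨ v ⟩ ⊎ ∃ λ g → g ∈ K × 2 * card ⟨ v ⟩ ≤ card ⟨ g ∷ v ⟩
  ⊆⟨⟩-or-doubles K v with any? (λ g → g ∈? K ×-dec ¬? (T? (⟨ v ⟩ g)))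
  ... | yes (g , g∈K , g∉⟨v⟩) = inj₂ (g , g∈K , ⟨∷⟩-doubles g∉⟨v⟩)
  ... | no ∄g = inj₁ λ {x} x∈K → decidable-stable (T? _) (λ x∉⟨v⟩ → ∄g (x , x∈K , x∉⟨v⟩))

  greedy-generators : ∀ {K} → Subgroup K → ∀ i →
                      ∃ λ (v : Vec (Fin n) i) → All (_∈ K) v × (K ⊆⟨ v ⟩ ⊎ 2 ^ i ≤ card ⟨ v ⟩)
  greedy-generators K-sub zero = [] , [] , inj₂ (card-pos ⟨ [] ⟩ (ε-closed (⟨⟩-isSubgroup [])))
  greedy-generators {K} K-sub@(ε∈K , _) (suc i) with greedy-generators K-sub i
  ... | v , v⊆K , inj₁ K⊆⟨v⟩ = ε ∷ v , ε∈K ∷ v⊆K , inj₁ (⟨⟩-⊆-∷ ∘ K⊆⟨v⟩)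
  ... | v , v⊆K , inj₂ large with ⊆⟨⟩-or-doubles K v
  ...   | inj₁ K⊆⟨v⟩ = ε ∷ v , ε∈K ∷ v⊆K , inj₁ (⟨⟩-⊆-∷ ∘ K⊆⟨v⟩)
  ...   | inj₂ (g , g∈K , doubles) = g ∷ v , g∈K ∷ v⊆K , inj₂ (≤-trans (*-monoʳ-≤ 2 large) doubles)

  proper-subgroup-generators : ∀ {K} L → Subgroup K → Proper _∙_ ε _⁻¹ K → n ≤ 2 ^ suc L →
                               ∃ λ (v : Vec (Fin n) L) → K ⊆⟨ v ⟩ × (∀ {x} → T (⟨ v ⟩ x) → x ∈ K)
  proper-subgroup-generators {K} L K-sub (x₀ , x₀∉K) n≤2ᴸ⁺¹ with greedy-generators K-sub L
  ... | v , v⊆K , spans-or-large = v , spans spans-or-large , (λ x∈ → ⟨⟩-least x∈ K-sub v⊆K)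
    where
    spans : K ⊆⟨ v ⟩ ⊎ 2 ^ L ≤ card ⟨ v ⟩ → K ⊆⟨ v ⟩
    spans (inj₁ K⊆⟨v⟩) = K⊆⟨v⟩
    spans (inj₂ large) with ⊆⟨⟩-or-doubles K v
    ... | inj₁ K⊆⟨v⟩ = K⊆⟨v⟩
    ... | inj₂ (g , g∈K , doubles) = ⊥-elim (<-irrefl refl (begin-strict
      2 ^ suc L              <⟨ ^-monoʳ-< 2 (s≤s (s≤s z≤n)) (n<1+n (suc L)) ⟩
      2 * (2 * 2 ^ L)        ≤⟨ *-monoʳ-≤ 2 (*-monoʳ-≤ 2 large) ⟩
      2 * (2 * card ⟨ v ⟩)   ≤⟨ *-monoʳ-≤ 2 doubles ⟩
      2 * card ⟨ g ∷ v ⟩     ≤⟨ card-proper-subgroup (⟨⟩-isSubgroup (g ∷ v)) x₀∉⟨g∷v⟩ ⟩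
      n                      ≤⟨ n≤2ᴸ⁺¹ ⟩
      2 ^ suc L              ∎))
      where
      open ≤-Reasoning
      x₀∉⟨g∷v⟩ : ¬ T (⟨ g ∷ v ⟩ x₀)
      x₀∉⟨g∷v⟩ x₀∈ = x₀∉K (⟨⟩-least x₀∈ K-sub (g∈K ∷ v⊆K))

  finite-order : ∀ g → ∃ λ d → suc d ⋆ g ≡ ε
  finite-order g with pigeonhole (n<1+n n) (λ i → toℕ i ⋆ g)
  ... | i , j , i<j , gⁱ≡gʲ = d , ∙-cancelˡ (toℕ i ⋆ g) _ _ (begin
    (toℕ i ⋆ g) ∙ (suc d ⋆ g)  ≡⟨ ×-homo-+ g (toℕ i) (suc d) ⟨
    (toℕ i + suc d) ⋆ g        ≡⟨ cong (_⋆ g) (trans (+-suc (toℕ i) d) (m+[n∸m]≡n i<j)) ⟩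
    toℕ j ⋆ g                  ≡⟨ gⁱ≡gʲ ⟨
    toℕ i ⋆ g                  ≡⟨ identityʳ _ ⟨
    (toℕ i ⋆ g) ∙ ε            ∎)
    where
    open ≡-Reasoning
    d = toℕ j ∸ suc (toℕ i)

  ClosedOutside : (Fin n → Bool) → Fin n → Subset n → Set
  ClosedOutside P h S = ∀ x → ¬ T (P x) → x ∈ S → x ∙ h ∈ S

  closedOutside? : ∀ P h S → Dec (ClosedOutside P h S)
  closedOutside? P h S = all? λ x → ¬? (T? (P x)) →-dec x ∈? S →-dec (x ∙ h) ∈? S

  module OrbitRepresentatives {P : Fin n → Bool} (P-sub : IsSubgroupᵇ P) {h : Fin n} (h∈P : T (P h))
                              (d : ℕ) (h^[1+d]≡ε : suc d ⋆ h ≡ ε) where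

    multiple-of-order : ∀ q → (q * suc d) ⋆ h ≡ ε
    multiple-of-order zero    = refl
    multiple-of-order (suc q) = begin
      (suc d + q * suc d) ⋆ h          ≡⟨ ×-homo-+ h (suc d) (q * suc d) ⟩
      (suc d ⋆ h) ∙ ((q * suc d) ⋆ h)  ≡⟨ cong₂ _∙_ h^[1+d]≡ε (multiple-of-order q) ⟩
      ε ∙ ε                            ≡⟨ identityˡ ε ⟩
      ε                                ∎
      where open ≡-Reasoning

    ⋆-mod : ∀ m → (m % suc d) ⋆ h ≡ m ⋆ h
    ⋆-mod m = sym (begin
      m ⋆ h                                            ≡⟨ cong (_⋆ h) (m≡m%n+[m/n]*n m (suc d)) ⟩
      (m % suc d + (m / suc d) * suc d) ⋆ h            ≡⟨ ×-homo-+ h (m % suc d) _ ⟩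
      ((m % suc d) ⋆ h) ∙ (((m / suc d) * suc d) ⋆ h)
        ≡⟨ cong (((m % suc d) ⋆ h) ∙_) (multiple-of-order (m / suc d)) ⟩
      ((m % suc d) ⋆ h) ∙ ε                            ≡⟨ identityʳ _ ⟩
      (m % suc d) ⋆ h                                  ∎)
      where open ≡-Reasoning

    ⋆-∈ : ∀ j → T (P (j ⋆ h))
    ⋆-∈ zero    = ε-closed P-sub
    ⋆-∈ (suc j) = ∙-closed P-sub h∈P (⋆-∈ j)

    [x∙h]∙hᵈ≡x : ∀ x → (x ∙ h) ∙ (d ⋆ h) ≡ x
    [x∙h]∙hᵈ≡x x = trans (assoc x h (d ⋆ h)) (trans (cong (x ∙_) h^[1+d]≡ε) (identityʳ x))

    -- The order of Fin n serves only to pick one point, the least, in each orbit x ⟨h⟩.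
    IsOrbitMin : Fin n → Set
    IsOrbitMin x = ∀ (k : Fin (suc d)) → toℕ x ≤ toℕ (x ∙ (toℕ k ⋆ h))

    orbitMin? : ∀ x → Dec (IsOrbitMin x)
    orbitMin? x = all? λ k → toℕ x ≤? toℕ (x ∙ (toℕ k ⋆ h))

    orbitMin-≤ : ∀ {x} → IsOrbitMin x → ∀ m → toℕ x ≤ toℕ (x ∙ (m ⋆ h))
    orbitMin-≤ {x} min m =
      subst (λ y → toℕ x ≤ toℕ (x ∙ y)) (trans (cong (_⋆ h) (toℕ-fromℕ< m%[1+d]<1+d)) (⋆-mod m))
            (min (fromℕ< m%[1+d]<1+d))
      where
      m%[1+d]<1+d : m % suc d < suc d
      m%[1+d]<1+d = m%n<n m (suc d)

    reach-orbitMin : ∀ x → Acc Fin._<_ x → ∃ λ j → IsOrbitMin (x ∙ (j ⋆ h))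
    reach-orbitMin x (acc smaller) with orbitMin? x
    ... | yes min = 0 , subst IsOrbitMin (sym (identityʳ x)) min
    ... | no ¬min with ¬∀⟶∃¬ (suc d) _ (λ k → toℕ x ≤? toℕ (x ∙ (toℕ k ⋆ h))) ¬min
    ...   | k , xhᵏ≮x with reach-orbitMin (x ∙ (toℕ k ⋆ h)) (smaller (≰⇒> xhᵏ≮x))
    ...     | j , min = toℕ k + j , subst IsOrbitMin (begin
      (x ∙ (toℕ k ⋆ h)) ∙ (j ⋆ h)  ≡⟨ assoc x _ _ ⟩
      x ∙ ((toℕ k ⋆ h) ∙ (j ⋆ h))  ≡⟨ cong (x ∙_) (×-homo-+ h (toℕ k) j) ⟨
      x ∙ ((toℕ k + j) ⋆ h)        ∎) min
      where open ≡-Reasoning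

    Rep : Fin n → Bool
    Rep x = not (P x) ∧ ⌊ orbitMin? x ⌋

    Rep-intro : ∀ {x} → ¬ T (P x) → IsOrbitMin x → T (Rep x)
    Rep-intro {x} x∉P min with P x
    ... | false = fromWitness min
    ... | true  = ⊥-elim (x∉P _)

    Rep-elim : ∀ {x} → T (Rep x) → ¬ T (P x) × IsOrbitMin x
    Rep-elim {x} x∈Rep with P x
    ... | false = (λ ()) , toWitness x∈Rep

    closed-⋆ : ∀ {S} → ClosedOutside P h S → ∀ {x} j → ¬ T (P x) → x ∈ S → x ∙ (j ⋆ h) ∈ S
    closed-⋆ closed {x} zero    x∉P x∈S = subst (_∈ _) (sym (identityʳ x)) x∈S
    closed-⋆ closed {x} (suc j) x∉P x∈S =
      subst (_∈ _) (assoc x h _) (closed-⋆ closed j (∙-∉ P-sub h∈P x∉P) (closed x x∉P x∈S))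

    -- Multiplying by h^d undoes multiplying by h, so closure under ∙ h also gives closure under ∙ h⁻¹.
    closed-⋆⁻ : ∀ {S} → ClosedOutside P h S → ∀ {x} j → ¬ T (P x) → x ∙ (j ⋆ h) ∈ S → x ∈ S
    closed-⋆⁻ closed {x} zero    x∉P xhʲ∈S = subst (_∈ _) (identityʳ x) xhʲ∈S
    closed-⋆⁻ closed {x} (suc j) x∉P xhʲ∈S =
      subst (_∈ _) ([x∙h]∙hᵈ≡x x) (closed-⋆ closed d xh∉P
        (closed-⋆⁻ closed j xh∉P (subst (_∈ _) (sym (assoc x h _)) xhʲ∈S)))
      where
      xh∉P = ∙-∉ P-sub h∈P x∉P

    orbit-determined : ∀ {S S′} → ClosedOutside P h S → ClosedOutside P h S′ →
                       (∀ {x} → T (P x ∨ Rep x) → x ∈ S → x ∈ S′) → S ⊆ S′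
    orbit-determined closed closed′ agree {x} x∈S with T? (P x)
    ... | yes x∈P = agree (Equivalence.from T-∨ (inj₁ x∈P)) x∈S
    ... | no  x∉P with reach-orbitMin x (<-wellFounded x)
    ...   | j , min = closed-⋆⁻ closed′ j x∉P (agree xhʲ∈Rep (closed-⋆ closed j x∉P x∈S))
      where
      xhʲ∈Rep = Equivalence.from T-∨ (inj₂ (Rep-intro (∙-∉ P-sub (⋆-∈ j) x∉P) min))

    Rep-∙h-∉Rep : h ≢ ε → ∀ {x} → T (Rep x) → ¬ T (Rep (x ∙ h))
    Rep-∙h-∉Rep h≢ε {x} x∈Rep xh∈Rep = h≢ε (∙-cancelˡ x h ε (trans xh≡x (sym (identityʳ x))))
      where
      x≤xh : toℕ x ≤ toℕ (x ∙ h)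
      x≤xh = subst (λ y → toℕ x ≤ toℕ (x ∙ y)) (×-homo-1 h) (orbitMin-≤ (proj₂ (Rep-elim x∈Rep)) 1)
      xh≤x : toℕ (x ∙ h) ≤ toℕ x
      xh≤x = subst (λ y → toℕ (x ∙ h) ≤ toℕ y) ([x∙h]∙hᵈ≡x x) (orbitMin-≤ (proj₂ (Rep-elim xh∈Rep)) d)
      xh≡x : x ∙ h ≡ x
      xh≡x = toℕ-injective (≤-antisym xh≤x x≤xh)

    card-P∨Rep : h ≢ ε → ∀ {x₀} → ¬ T (P x₀) → 4 * card (λ x → P x ∨ Rep x) ≤ 3 * n
    card-P∨Rep h≢ε x₀∉P = begin
      4 * card (λ x → P x ∨ Rep x)                ≤⟨ *-monoʳ-≤ 4 (card-∨ P Rep) ⟩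
      4 * (card P + card Rep)                     ≡⟨ regroup (card P) (card Rep) ⟩
      2 * card P + 2 * (card P + 2 * card Rep)
        ≤⟨ +-mono-≤ (card-proper-subgroup P-sub x₀∉P) (*-monoʳ-≤ 2 (+-monoʳ-≤ (card P) 2∣Rep∣≤∣∁P∣)) ⟩
      n + 2 * (card P + card (not ∘ P))           ≡⟨ cong (λ m → n + 2 * m) (card-not P) ⟩
      3 * n                                       ∎
      where
      open ≤-Reasoning
      regroup : ∀ a b → 4 * (a + b) ≡ 2 * a + 2 * (a + 2 * b)
      regroup = solve-∀
      Rep⊆∁P : ∀ {x} → T (Rep x) → T (not (P x))
      Rep⊆∁P = proj₁ ∘ Equivalence.to T-∧
      2∣Rep∣≤∣∁P∣ : 2 * card Rep ≤ card (not ∘ P)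
      2∣Rep∣≤∣∁P∣ = card-double (rightTranslation h) (Rep-∙h-∉Rep h≢ε) Rep⊆∁P
                      (T-not⁺ ∘ ∙-∉ P-sub h∈P ∘ proj₁ ∘ Rep-elim)

    count-closedOutside : h ≢ ε → ∀ {x₀} → ¬ T (P x₀) →
                          countSubsets (λ S → ⌊ closedOutside? P h S ⌋) ≤ 2 ^ (3 * n / 4)
    count-closedOutside h≢ε x₀∉P = begin
      countSubsets (λ S → ⌊ closedOutside? P h S ⌋)
        ≤⟨ count-determined _ (λ x → P x ∨ Rep x)
             (λ c c′ → orbit-determined (toWitness c) (toWitness c′)) ⟩
      2 ^ card (λ x → P x ∨ Rep x)
        ≤⟨ ^-monoʳ-≤ 2 (*-≤⇒≤-/ 4 {card (λ x → P x ∨ Rep x)} (card-P∨Rep h≢ε x₀∉P)) ⟩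
      2 ^ (3 * n / 4)               ∎
      where open ≤-Reasoning

  -- A code h ∷ v stands for the element h ∈ H and the generators v of K.
  Configuration : ∀ {k} → Vec (Fin n) k → Fin n → Set
  Configuration v h = h ≢ ε × T (⟨ v ⟩ h) × ∃ λ x₀ → ¬ T (⟨ v ⟩ x₀)

  configuration? : ∀ {k} (v : Vec (Fin n) k) h → Dec (Configuration v h)
  configuration? v h = ¬? (h ≟ ε) ×-dec T? (⟨ v ⟩ h) ×-dec any? (λ x → ¬? (T? (⟨ v ⟩ x)))

  coded : ∀ {L} → Vec (Fin n) (suc L) → Subset n → Bool
  coded (h ∷ v) S = ⌊ configuration? v h ×-dec closedOutside? ⟨ v ⟩ h S ⌋

  count-coded : ∀ {L} (w : Vec (Fin n) (suc L)) → countSubsets (coded w) ≤ 2 ^ (3 * n / 4)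
  count-coded (h ∷ v) = by-configuration (configuration? v h)
    where
    by-configuration : Dec (Configuration v h) → countSubsets (coded (h ∷ v)) ≤ 2 ^ (3 * n / 4)
    by-configuration (yes (h≢ε , h∈⟨v⟩ , x₀ , x₀∉⟨v⟩)) = ≤-trans
      (count-mono {f = coded (h ∷ v)} {g = λ S → ⌊ closedOutside? ⟨ v ⟩ h S ⌋}
                  (fromWitness ∘ proj₂ ∘ toWitness))
      (let d , h^[1+d]≡ε = finite-order h in
       OrbitRepresentatives.count-closedOutside (⟨⟩-isSubgroup v) h∈⟨v⟩ d h^[1+d]≡ε h≢ε x₀∉⟨v⟩)
    by-configuration (no ¬config) =
      ≤-trans (≤-reflexive (count-∅ (coded (h ∷ v)) (¬config ∘ proj₁ ∘ toWitness))) z≤n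

  #GoodLeft≤ : ∀ L → n ≤ 2 ^ suc L → #GoodLeft _∙_ ε _⁻¹ ≤ n ^ suc L * 2 ^ (3 * n / 4)
  #GoodLeft≤ L n≤2ᴸ⁺¹ = count-cover (suc L) coded _ count-coded good⇒coded
    where
    good⇒coded : ∀ {S} → T ⌊ goodLeft? _∙_ ε _⁻¹ S ⌋ → ∃ λ w → T (coded w S)
    good⇒coded {S} good with toWitness good
    ... | H , K , _ , K-sub , (h , h∈H , h≢ε) , H⊆K , K-proper@(x₀ , x₀∉K) , S∖K-closed
        with proper-subgroup-generators L K-sub K-proper n≤2ᴸ⁺¹
    ...   | v , K⊆⟨v⟩ , ⟨v⟩⊆K =
      h ∷ v , fromWitness ((h≢ε , K⊆⟨v⟩ (H⊆K h∈H) , x₀ , x₀∉K ∘ ⟨v⟩⊆K) , closed)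
      where
      closed : ClosedOutside ⟨ v ⟩ h S
      closed x x∉⟨v⟩ x∈S =
        proj₁ (x∈p∩q⁻ S _ (S∖K-closed x h (x∈p∩q⁺ (x∈S , x∉p⇒x∈∁p (x∉⟨v⟩ ∘ K⊆⟨v⟩))) h∈H))

#GoodRight≤#GoodLeftᵒᵖ : ∀ {n} (_∙_ : Op₂ (Fin n)) ε _⁻¹ →
                         #GoodRight _∙_ ε _⁻¹ ≤ #GoodLeft (flip _∙_) ε _⁻¹
#GoodRight≤#GoodLeftᵒᵖ _∙_ ε _⁻¹ = count-mono {f = λ S → ⌊ goodRight? _∙_ ε _⁻¹ S ⌋} λ good →
  let H , K , H-sub , K-sub , rest = toWitness good
  in  fromWitness (H , K , opposite H-sub , opposite K-sub , rest)
  where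
  opposite : ∀ {H} → IsSubgroup _∙_ ε _⁻¹ H → IsSubgroup (flip _∙_) ε _⁻¹ H
  opposite (ε∈H , ∙-closed , ⁻¹-closed) = ε∈H , (λ x y x∈H y∈H → ∙-closed y x y∈H x∈H) , ⁻¹-closed

lemma5p1 : (n : ℕ) (_∙_ : Op₂ (Fin n)) (ε : Fin n) (_⁻¹ : Op₁ (Fin n))
    → IsGroup _≡_ _∙_ ε _⁻¹
    → (a b : ℕ) → 0 < b → n ^ b < 2 ^ a
    → (#GoodLeft _∙_ ε _⁻¹ ^ (4 * (b * b)) ≤ 2 ^ (3 * n * (b * b) + 8 * (a * a)))
    × (#GoodRight _∙_ ε _⁻¹ ^ (4 * (b * b)) ≤ 2 ^ (3 * n * (b * b) + 8 * (a * a)))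
lemma5p1 n _∙_ ε _⁻¹ isGroup a b _ nᵇ<2ᵃ =
    bound-from-counts a b nᵇ<2ᵃ (#GoodLeft≤ isGroup)
  , bound-from-counts a b nᵇ<2ᵃ (λ L n≤2ᴸ⁺¹ →
      ≤-trans (#GoodRight≤#GoodLeftᵒᵖ _∙_ ε _⁻¹) (#GoodLeft≤ (Flip.isGroup isGroup) L n≤2ᴸ⁺¹))
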